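{- Let $A$ be a finite alphabet and $f\colon A^*\to A^*$ a Parikh-collinear morphism prolongable on $a\in A$. Let $B=\{b\in A\colon f^n(b)\neq\varepsilon \text{ for all } n\ge0\}$ and $C=\{b\in A\colon f(b)=\varepsilon\}$ (so that $A=B\cup C$). Let $\kappa\colon A^*\to B^*$ be the morphism with $\kappa(b)=b$ for $b\in B$ and $\kappa(c)=\varepsilon$ for $c\in C$, and let $g\colon B^*\to B^*$ be defined by $g(b)=\kappa(f(b))$ for $b\in B$. Then $g$ is a non-erasing Parikh-collinear morphism prolongable on $a$, and $f(g^{\omega}(a))=f^{\omega}(a)$.
   Context: For $w$ a word, $\Psi(w)$ is its Parikh vector (numbers of occurrences of each letter, for a fixed order on the alphabet). A morphism is Parikh-collinear if the Parikh vectors of the images of the letters are pairwise $\mathbb{Z}$-linearly dependent; it is non-erasing if no letter is mapped to the empty word $\varepsilon$. A morphism $f$ is prolongable on $a$ if $f(a)=au$ for some word $u$ and $|f^n(a)|\to\infty$; then $f^{\omega}(a)=\lim_n f^n(a)$ is its infinite fixed point starting with $a$. The image of an infinite word under a morphism is defined letter by letter. -}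

module Defs where

open import Data.Nat using (ℕ; zero; suc; _≤_; _<_)
open import Data.Integer as ℤ using (ℤ; +_)
open import Data.Fin using (Fin; fromℕ<)
open import Data.Fin.Properties using () renaming (_≟_ to _≟ᶠ_)
open import Data.List using (List; []; _∷_; length; concatMap; lookup; map; upTo; filter)
open import Data.Product using (Σ; ∃; _×_; ∃-syntax)
open import Relation.Nullary using (¬_; Dec; yes; no)
open import Relation.Nullary.Decidable using (¬?)
open import Relation.Binary.PropositionalEquality using (_≡_; _≢_)

Word : ℕ → Set
Word k = List (Fin k)

InfWord : ℕ → Set
InfWord k = ℕ → Fin k

Morphism : ℕ → Set
Morphism k = Fin k → Word k

apply : ∀ {k} → Morphism k → Word k → Word k
apply h w = concatMap h w

iter : ∀ {k} → Morphism k → ℕ → Word k → Word k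
iter h zero    w = w
iter h (suc n) w = apply h (iter h n w)

Ψ : ∀ {k} → Word k → Fin k → ℕ
Ψ w i = length (filter (_≟ᶠ i) w)

LinDep : ∀ {k} → (Fin k → ℕ) → (Fin k → ℕ) → Set
LinDep {k} u v = ∃[ x ] ∃[ y ] (¬ (x ≡ + 0 × y ≡ + 0) ×
  (∀ (i : Fin k) → x ℤ.* (+ u i) ℤ.+ y ℤ.* (+ v i) ≡ + 0))

ParikhCollinear : ∀ {k} → Morphism k → Set
ParikhCollinear h = ∀ b c → LinDep (Ψ (h b)) (Ψ (h c))

Prolongable : ∀ {k} → Morphism k → Fin k → Set
Prolongable h a = (∃[ u ] h a ≡ a ∷ u) ×
  (∀ (N : ℕ) → ∃[ n ] N ≤ length (iter h n (a ∷ [])))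

PrefixOf : ∀ {k} → Word k → InfWord k → Set
PrefixOf u w = ∀ i (p : i < length u) → lookup u (fromℕ< p) ≡ w i

IsLimit : ∀ {k} → (ℕ → Word k) → InfWord k → Set
IsLimit ws w = (∀ n → PrefixOf (ws n) w) × (∀ (N : ℕ) → ∃[ n ] N ≤ length (ws n))

IsFixedPoint : ∀ {k} → Morphism k → Fin k → InfWord k → Set
IsFixedPoint h a w = IsLimit (λ n → iter h n (a ∷ [])) w

takeInf : ∀ {k} → ℕ → InfWord k → Word k
takeInf n x = map x (upTo n)

IsImage : ∀ {k} → Morphism k → InfWord k → InfWord k → Set
IsImage h x y = IsLimit (λ n → apply h (takeInf n x)) y

InB : ∀ {k} → Morphism k → Fin k → Set
InB f b = ∀ n → iter f n (b ∷ []) ≢ []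

InC : ∀ {k} → Morphism k → Fin k → Set
InC f c = f c ≡ []

isEmpty? : ∀ {k} (w : Word k) → Dec (w ≡ [])
isEmpty? []      = yes _≡_.refl
isEmpty? (_ ∷ _) = no (λ ())

-- κ : erases the letters of C and keeps the others (= the letters of B, since A = B ∪ C).
κ : ∀ {k} → Morphism k → Word k → Word k
κ f w = filter (λ c → ¬? (isEmpty? (f c))) w

-- g(b) = κ(f(b)); only its values on B are relevant (g is a morphism B* → B*).
gMor : ∀ {k} → Morphism k → Morphism k
gMor f b = κ f (f b)

{-# OPTIONS --safe #-}
-- The morphism f erases exactly the letters that κ deletes, so f ∘ κ = f, hence f ∘ g = f ∘ f
-- and f ∘ gⁿ = fⁿ⁺¹ on words.  Thus the images under f of the prefixes gⁿ(a) of g^ω(a) are the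
-- prefixes fⁿ⁺¹(a) of f^ω(a), and |fⁿ⁺¹(a)| ≤ M·|gⁿ(a)| (M bounding |f(c)|) makes gⁿ(a) grow.
-- On Parikh vectors κ only zeroes some coordinates, which preserves collinearity.  Finally
-- Ψ(f(a)) has a nonzero a-coordinate, so collinearity puts a into every nonempty f(b); as a
-- survives κ, g(b) ≠ ε for b ∈ B.
module Submission where

open import Defs
open import Level using (Level)
open import Function using (_∘_)
open import Data.Nat using (ℕ; zero; suc; _+_; _*_; _≤_; NonZero; z≤n; s≤s)
import Data.Nat.Properties as ℕ
open import Data.Integer as ℤ using (ℤ; +_)
import Data.Integer.Properties as ℤ
open import Data.Fin using (Fin)
open import Data.Fin.Properties using () renaming (_≟_ to _≟ᶠ_)
open import Data.List using ([]; _∷_; _++_; length; take; drop; applyUpTo; map; filter; allFin)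
import Data.List.Properties as List
import Data.List.Relation.Unary.All as All
open import Data.List.Relation.Unary.All.Properties using (all-filter)
open import Data.List.Membership.Propositional.Properties using (∈-allFin; ∈-map⁺)
open import Data.List.Extrema.Nat using (max; xs≤max)
open import Data.Product using (∃-syntax; _×_; _,_; proj₁; proj₂; map₂)
open import Data.Sum using (inj₁; inj₂)
open import Data.Empty using (⊥-elim)
open import Relation.Nullary using (¬_; yes; no)
open import Relation.Nullary.Decidable using (¬?; decidable-stable)
open import Relation.Unary using (Pred; Decidable; _⊆_)
open import Relation.Binary.PropositionalEquality
  using (_≡_; _≢_; refl; sym; trans; cong; cong₂; subst; module ≡-Reasoning)

private
  variable
    p q : Level
    A : Set
    k : ℕ

module _ {P : Pred A p} {Q : Pred A q} (P? : Decidable P) (Q? : Decidable Q) where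

  filter-filter-⊆ : Q ⊆ P → ∀ xs → filter Q? (filter P? xs) ≡ filter Q? xs
  filter-filter-⊆ Q⊆P [] = refl
  filter-filter-⊆ Q⊆P (x ∷ xs) with Q? x
  ... | yes Qx = begin
    filter Q? (filter P? (x ∷ xs)) ≡⟨ cong (filter Q?) (List.filter-accept P? (Q⊆P Qx)) ⟩
    filter Q? (x ∷ filter P? xs)   ≡⟨ List.filter-accept Q? Qx ⟩
    x ∷ filter Q? (filter P? xs)   ≡⟨ cong (x ∷_) (filter-filter-⊆ Q⊆P xs) ⟩
    x ∷ filter Q? xs               ∎
    where open ≡-Reasoning
  ... | no ¬Qx with P? x
  ...   | yes _ = trans (List.filter-reject Q? ¬Qx) (filter-filter-⊆ Q⊆P xs)
  ...   | no _  = filter-filter-⊆ Q⊆P xs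

  filter-filter-disjoint : (∀ {x} → P x → ¬ Q x) → ∀ xs → filter Q? (filter P? xs) ≡ []
  filter-filter-disjoint P⇒¬Q xs = List.filter-none Q? (All.map P⇒¬Q (all-filter P? xs))

Unbounded : (ℕ → ℕ) → Set
Unbounded ℓ = ∀ N → ∃[ n ] N ≤ ℓ n

-- The threshold 1 + ℓ 0 + N rules out the witness 0.
Unbounded-suc : ∀ {ℓ} → Unbounded ℓ → Unbounded (ℓ ∘ suc)
Unbounded-suc {ℓ} unbounded N with unbounded (suc (ℓ 0) + N)
... | zero  , ≤ℓ0 = ⊥-elim (ℕ.n≮n (ℓ 0) (ℕ.m+n≤o⇒m≤o (suc (ℓ 0)) ≤ℓ0))
... | suc n , ≤ℓn = n , ℕ.≤-trans (ℕ.m≤n+m N (suc (ℓ 0))) ≤ℓn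

Unbounded-≤-* : ∀ {ℓ ℓ′} M .{{_ : NonZero M}} → (∀ n → ℓ n ≤ M * ℓ′ n) →
                Unbounded ℓ → Unbounded ℓ′
Unbounded-≤-* M ℓ≤Mℓ′ unbounded N with unbounded (M * N)
... | n , MN≤ℓn = n , ℕ.*-cancelˡ-≤ M (ℕ.≤-trans MN≤ℓn (ℓ≤Mℓ′ n))

module _ (h : Morphism k) where

  maxImageLength : ℕ
  maxImageLength = max 0 (map (length ∘ h) (allFin k))

  length-image-≤ : ∀ c → length (h c) ≤ maxImageLength
  length-image-≤ c = All.lookup (xs≤max 0 _) (∈-map⁺ (length ∘ h) (∈-allFin c))

  length-apply-≤ : ∀ {M} → (∀ c → length (h c) ≤ M) → ∀ w → length (apply h w) ≤ M * length w
  length-apply-≤ bound [] = z≤n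
  length-apply-≤ {M} bound (c ∷ w) = begin
    length (h c ++ apply h w)          ≡⟨ List.length-++ (h c) ⟩
    length (h c) + length (apply h w) ≤⟨ ℕ.+-mono-≤ (bound c) (length-apply-≤ bound w) ⟩
    M + M * length w                   ≡⟨ ℕ.*-suc M (length w) ⟨
    M * length (c ∷ w)                 ∎
    where open ℕ.≤-Reasoning

  apply-filter : ∀ {P : Pred (Fin k) p} (P? : Decidable P) w →
                 apply (filter P? ∘ h) w ≡ filter P? (apply h w)
  apply-filter P? [] = refl
  apply-filter P? (c ∷ w) =
    trans (cong (filter P? (h c) ++_) (apply-filter P? w)) (sym (List.filter-++ P? (h c) (apply h w)))

  apply-filter-erased : ∀ {P : Pred (Fin k) p} (P? : Decidable P) → (∀ {c} → ¬ P c → h c ≡ []) →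
                        ∀ w → apply h (filter P? w) ≡ apply h w
  apply-filter-erased P? erased [] = refl
  apply-filter-erased P? erased (c ∷ w) with P? c
  ... | yes _  = cong (h c ++_) (apply-filter-erased P? erased w)
  ... | no ¬Pc = trans (apply-filter-erased P? erased w) (cong (_++ apply h w) (sym (erased ¬Pc)))

module _ {P : Pred (Fin k) p} (P? : Decidable P) where

  Ψ-filter-accept : ∀ {i} → P i → ∀ w → Ψ (filter P? w) i ≡ Ψ w i
  Ψ-filter-accept Pi w = cong length (filter-filter-⊆ P? (_≟ᶠ _) (λ { refl → Pi }) w)

  Ψ-filter-reject : ∀ {i} → ¬ P i → ∀ w → Ψ (filter P? w) i ≡ 0
  Ψ-filter-reject ¬Pi w = cong length (filter-filter-disjoint P? (_≟ᶠ _) (λ { Pc refl → ¬Pi Pc }) w)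

  LinDep-Ψ-filter : ∀ {u v : Word k} → LinDep (Ψ u) (Ψ v) → LinDep (Ψ (filter P? u)) (Ψ (filter P? v))
  LinDep-Ψ-filter {u} {v} (x , y , nontrivial , dependent) = x , y , nontrivial , dependent′
    where
    combination : ℕ → ℕ → ℤ
    combination m n = x ℤ.* + m ℤ.+ y ℤ.* + n

    dependent′ : ∀ i → combination (Ψ (filter P? u) i) (Ψ (filter P? v) i) ≡ + 0
    dependent′ i with P? i
    ... | yes Pi = trans (cong₂ combination (Ψ-filter-accept Pi u) (Ψ-filter-accept Pi v)) (dependent i)
    ... | no ¬Pi = trans (cong₂ combination (Ψ-filter-reject ¬Pi u) (Ψ-filter-reject ¬Pi v))
                         (cong₂ ℤ._+_ (ℤ.*-zeroʳ x) (ℤ.*-zeroʳ y))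

Ψ-∷-self : ∀ (c : Fin k) w → Ψ (c ∷ w) c ≡ suc (Ψ w c)
Ψ-∷-self c w = cong length (List.filter-accept (_≟ᶠ c) refl)

Ψ-nonempty : ∀ {w : Word k} → w ≢ [] → ∃[ i ] Ψ w i ≢ 0
Ψ-nonempty {w = []}    w≢[] = ⊥-elim (w≢[] refl)
Ψ-nonempty {w = c ∷ w} _    = c , λ Ψ≡0 → ℕ.0≢1+n (trans (sym Ψ≡0) (Ψ-∷-self c w))

LinDep-support : ∀ {u v : Fin k → ℕ} {i j} → LinDep u v → u i ≢ 0 → v j ≢ 0 → v i ≢ 0
LinDep-support {u = u} {v} {i} {j} (x , y , nontrivial , dependent) ui≢0 vj≢0 vi≡0 =
  nontrivial (x≡0 , y≡0)
  where
  open ≡-Reasoning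

  factor≡0 : ∀ {z n} → n ≢ 0 → z ℤ.* + n ≡ + 0 → z ≡ + 0
  factor≡0 n≢0 zn≡0 with ℤ.i*j≡0⇒i≡0∨j≡0 _ zn≡0
  ... | inj₁ z≡0 = z≡0
  ... | inj₂ n≡0 = ⊥-elim (n≢0 (cong ℤ.∣_∣ n≡0))

  x≡0 : x ≡ + 0
  x≡0 = factor≡0 ui≢0 (begin
    x ℤ.* + u i                     ≡⟨ ℤ.+-identityʳ _ ⟨
    x ℤ.* + u i ℤ.+ + 0             ≡⟨ cong (λ z → x ℤ.* + u i ℤ.+ z) (ℤ.*-zeroʳ y) ⟨
    x ℤ.* + u i ℤ.+ y ℤ.* + 0       ≡⟨ cong (λ n → x ℤ.* + u i ℤ.+ y ℤ.* + n) vi≡0 ⟨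
    x ℤ.* + u i ℤ.+ y ℤ.* + v i     ≡⟨ dependent i ⟩
    + 0                             ∎)

  y≡0 : y ≡ + 0
  y≡0 = factor≡0 vj≢0 (begin
    y ℤ.* + v j                     ≡⟨ ℤ.+-identityˡ _ ⟨
    + 0 ℤ.* + u j ℤ.+ y ℤ.* + v j   ≡⟨ cong (λ z → z ℤ.* + u j ℤ.+ y ℤ.* + v j) x≡0 ⟨
    x ℤ.* + u j ℤ.+ y ℤ.* + v j     ≡⟨ dependent j ⟩
    + 0                             ∎)

module _ {c : Fin k} {v : Word k} {x : InfWord k} where

  PrefixOf-∷⁻ : PrefixOf (c ∷ v) x → c ≡ x 0 × PrefixOf v (x ∘ suc)
  PrefixOf-∷⁻ prefix = prefix 0 (s≤s z≤n) , λ i i< → prefix (suc i) (s≤s i<)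

PrefixOf-++⁻ˡ : ∀ (u : Word k) {t x} → PrefixOf (u ++ t) x → PrefixOf u x
PrefixOf-++⁻ˡ (c ∷ u) prefix zero    _       = proj₁ (PrefixOf-∷⁻ prefix)
PrefixOf-++⁻ˡ (c ∷ u) prefix (suc i) (s≤s i<) = PrefixOf-++⁻ˡ u (proj₂ (PrefixOf-∷⁻ prefix)) i i<

IsLimit-cong : ∀ {us vs : ℕ → Word k} {w} → (∀ n → us n ≡ vs n) → IsLimit us w → IsLimit vs w
IsLimit-cong {w = w} us≡vs (prefix , unbounded) =
  (λ n → subst (λ u → PrefixOf u w) (us≡vs n) (prefix n)) ,
  (λ N → map₂ (subst (λ u → N ≤ length u) (us≡vs _)) (unbounded N))

IsLimit-suc : ∀ {ws : ℕ → Word k} {w} → IsLimit ws w → IsLimit (ws ∘ suc) w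
IsLimit-suc (prefix , unbounded) = prefix ∘ suc , Unbounded-suc unbounded

applyUpTo-≡-take : ∀ {n} {v : Word k} {x} → n ≤ length v → PrefixOf v x → applyUpTo x n ≡ take n v
applyUpTo-≡-take {n = zero}              _         _      = refl
applyUpTo-≡-take {n = suc n} {v = c ∷ v} (s≤s n≤) prefix =
  let c≡x0 , prefix′ = PrefixOf-∷⁻ prefix in cong₂ _∷_ (sym c≡x0) (applyUpTo-≡-take n≤ prefix′)

takeInf-≡-take : ∀ {n} {v : Word k} {x} → n ≤ length v → PrefixOf v x → takeInf n x ≡ take n v
takeInf-≡-take {n = n} {x = x} n≤ prefix = trans (List.map-upTo x n) (applyUpTo-≡-take n≤ prefix)

takeInf-length : ∀ {v : Word k} {x} → PrefixOf v x → takeInf (length v) x ≡ v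
takeInf-length {v = v} prefix =
  trans (takeInf-≡-take ℕ.≤-refl prefix) (List.take-all (length v) v ℕ.≤-refl)

PrefixOf-apply-take : ∀ (h : Morphism k) n v {w} → PrefixOf (apply h v) w → PrefixOf (apply h (take n v)) w
PrefixOf-apply-take h n v prefix =
  PrefixOf-++⁻ˡ (apply h (take n v)) (subst (λ u → PrefixOf u _) split prefix)
  where
  split : apply h v ≡ apply h (take n v) ++ apply h (drop n v)
  split = trans (cong (apply h) (sym (List.take++drop≡id n v))) (List.concatMap-++ h (take n v) (drop n v))

IsLimit-apply⇒IsImage : ∀ (h : Morphism k) {vs x w} → IsLimit vs x → IsLimit (apply h ∘ vs) w → IsImage h x w
IsLimit-apply⇒IsImage h {vs} {x} {w} (vs-prefix , vs-unbounded) (hvs-prefix , hvs-unbounded) =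
  image-prefix , image-unbounded
  where
  image-prefix : ∀ n → PrefixOf (apply h (takeInf n x)) w
  image-prefix n with vs-unbounded n
  ... | m , n≤ = subst (λ u → PrefixOf (apply h u) w) (sym (takeInf-≡-take {v = vs m} n≤ (vs-prefix m)))
                   (PrefixOf-apply-take h n (vs m) (hvs-prefix m))

  image-unbounded : Unbounded (λ n → length (apply h (takeInf n x)))
  image-unbounded N with hvs-unbounded N
  ... | m , N≤ = length (vs m) ,
                 subst (λ u → N ≤ length (apply h u)) (sym (takeInf-length {v = vs m} (vs-prefix m))) N≤

module Erasure (f : Morphism k) where

  nonErased? : Decidable (λ c → f c ≢ [])
  nonErased? c = ¬? (isEmpty? (f c))

  apply-κ : ∀ w → apply f (κ f w) ≡ apply f w
  apply-κ = apply-filter-erased f nonErased? (λ {c} → decidable-stable (isEmpty? (f c)))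

  apply-iter-gMor : ∀ n w → apply f (iter (gMor f) n w) ≡ iter f (suc n) w
  apply-iter-gMor zero    w = refl
  apply-iter-gMor (suc n) w = begin
    apply f (apply (gMor f) gⁿw) ≡⟨ cong (apply f) (apply-filter f nonErased? gⁿw) ⟩
    apply f (κ f (apply f gⁿw))  ≡⟨ apply-κ (apply f gⁿw) ⟩
    apply f (apply f gⁿw)        ≡⟨ cong (apply f) (apply-iter-gMor n w) ⟩
    apply f (iter f (suc n) w)   ∎
    where
    open ≡-Reasoning
    gⁿw : Word k
    gⁿw = iter (gMor f) n w

  length-iter-≤ : ∀ n w → length (iter f (suc n) w) ≤ suc (maxImageLength f) * length (iter (gMor f) n w)
  length-iter-≤ n w = subst (λ u → length u ≤ M * length (iter (gMor f) n w)) (apply-iter-gMor n w)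
    (length-apply-≤ f (λ c → ℕ.m≤n⇒m≤1+n (length-image-≤ f c)) (iter (gMor f) n w))
    where M = suc (maxImageLength f)

  InB⇒nonErased : ∀ {b} → InB f b → f b ≢ []
  InB⇒nonErased b∈B fb≡[] = b∈B 1 (cong (_++ []) fb≡[])

  module _ {a u} (fa≡au : f a ≡ a ∷ u) where

    iter-head : ∀ n → ∃[ t ] iter f n (a ∷ []) ≡ a ∷ t
    iter-head zero = [] , refl
    iter-head (suc n) with iter-head n
    ... | t , fⁿa≡at = u ++ apply f t , trans (cong (apply f) fⁿa≡at) (cong (_++ apply f t) fa≡au)

    a∈B : InB f a
    a∈B n fⁿa≡[] with trans (sym (proj₂ (iter-head n))) fⁿa≡[]
    ... | ()

    gMor-a : gMor f a ≡ a ∷ κ f u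
    gMor-a = trans (cong (κ f) fa≡au) (List.filter-accept nonErased? (InB⇒nonErased a∈B))

    Ψ-f-a : Ψ (f a) a ≢ 0
    Ψ-f-a Ψ≡0 = ℕ.0≢1+n (trans (sym Ψ≡0) (trans (cong (λ w → Ψ w a) fa≡au) (Ψ-∷-self a u)))

    gMor-nonErasing : ParikhCollinear f → ∀ {b} → InB f b → gMor f b ≢ []
    gMor-nonErasing collinear {b} b∈B gb≡[] = Ψ-fb-a≢0
      (trans (sym (Ψ-filter-accept nonErased? (InB⇒nonErased a∈B) (f b))) (cong (λ w → Ψ w a) gb≡[]))
      where
      Ψ-fb-a≢0 : Ψ (f b) a ≢ 0
      Ψ-fb-a≢0 = LinDep-support (collinear a b) Ψ-f-a (proj₂ (Ψ-nonempty (InB⇒nonErased b∈B)))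

lemma5 : (k : ℕ) (f : Morphism k) (a : Fin k) →
    ParikhCollinear f → Prolongable f a →
    -- g : B* → B* is non-erasing
    ((∀ b → InB f b → gMor f b ≢ [])
    -- g is Parikh-collinear (on B)
    × (∀ b c → InB f b → InB f c → LinDep (Ψ (gMor f b)) (Ψ (gMor f c)))
    -- a ∈ B and g is prolongable on a
    × InB f a × Prolongable (gMor f) a
    -- f(g^ω(a)) = f^ω(a)
    × (∀ (x w : InfWord k) → IsFixedPoint (gMor f) a x → IsFixedPoint f a w →
         IsImage f x w))
lemma5 k f a collinear ((u , fa≡au) , f-unbounded) =
  (λ _ → gMor-nonErasing fa≡au collinear) ,
  (λ b c _ _ → LinDep-Ψ-filter nonErased? {f b} {f c} (collinear b c)) ,
  a∈B fa≡au ,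
  ((κ f u , gMor-a fa≡au) , g-unbounded) ,
  λ x w x-limit w-limit → IsLimit-apply⇒IsImage f {vs = gⁿa} x-limit (f∘gⁿa-limit w-limit)
  where
  open Erasure f

  gⁿa : ℕ → Word k
  gⁿa n = iter (gMor f) n (a ∷ [])

  f∘gⁿa-limit : ∀ {w} → IsFixedPoint f a w → IsLimit (apply f ∘ gⁿa) w
  f∘gⁿa-limit =
    IsLimit-cong (λ n → sym (apply-iter-gMor n (a ∷ []))) ∘ IsLimit-suc {ws = λ n → iter f n (a ∷ [])}

  g-unbounded : Unbounded (length ∘ gⁿa)
  g-unbounded =
    Unbounded-≤-* (suc (maxImageLength f)) (λ n → length-iter-≤ n (a ∷ [])) (Unbounded-suc f-unbounded)
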